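{- Let $G$ be a graph with $n$ vertices and $m$ edges and $k\le n$ a nonnegative integer such that $G$ has no loops, every edge has multiplicity at most $2$, every vertex has degree at least $3$, and some vertex has degree at least $4$. If $G$ has a feedback vertex set of size $k$ and $m\ge 28k$, then a vertex $v$ sampled with probability $(\deg(v)-3)/\sum_{u\in V}(\deg(u)-3)$ belongs to a feedback vertex set of $G$ of size at most $k$ with probability at least $4/11$.
   Context: Graphs may have parallel edges; $m$ counts edges with multiplicity and degrees count multiplicities. A feedback vertex set of $G=(V,E)$ is a set $F\subseteq V$ such that $G[V\setminus F]$ is a forest (acyclic, where a pair of parallel edges forms a cycle). -}

module Defs where

open import Data.Nat using (ℕ; zero; suc; _+_; _*_; _∸_; _≤_)
open import Data.Fin using (Fin; zero; suc; inject₁; fromℕ; _≟_)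
open import Data.Fin.Subset using (Subset; _∈_; _∉_; ∣_∣)
open import Data.Product using (_×_; _,_; proj₁; proj₂; Σ; ∃)
open import Data.Sum using (_⊎_)
open import Data.Bool using (Bool; true; false; if_then_else_; _∧_; _∨_)
open import Data.List using (List; map; allFin)
open import Data.Nat.ListAction using (sum)
open import Data.Vec using (lookup)
open import Relation.Nullary using (¬_; does)
open import Relation.Binary.PropositionalEquality using (_≡_; _≢_)
open import Function.Definitions using (Injective)

-- A multigraph with vertex set Fin n and edge set Fin m:
-- edge e has (unordered) endpoints given by the pair  ends e.
-- Parallel edges are allowed (distinct edge indices with the same ends).
Multigraph : ℕ → ℕ → Set
Multigraph n m = Fin m → Fin n × Fin n

Σ-over : (k : ℕ) → (Fin k → ℕ) → ℕ
Σ-over k f = sum (map f (allFin k))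

ind : Bool → ℕ
ind b = if b then 1 else 0

deg : ∀ {n m} → Multigraph n m → Fin n → ℕ
deg {n} {m} G v = Σ-over m (λ e → ind (does (v ≟ proj₁ (G e))) + ind (does (v ≟ proj₂ (G e))))

-- multiplicity of the pair {u, v} (meaningful for u ≢ v)
mult : ∀ {n m} → Multigraph n m → Fin n → Fin n → ℕ
mult {n} {m} G u v = Σ-over m (λ e →
  ind ((does (u ≟ proj₁ (G e)) ∧ does (v ≟ proj₂ (G e)))
     ∨ (does (v ≟ proj₁ (G e)) ∧ does (u ≟ proj₂ (G e)))))

NoLoops : ∀ {n m} → Multigraph n m → Set
NoLoops {n} {m} G = (e : Fin m) → proj₁ (G e) ≢ proj₂ (G e)

Joins : ∀ {n m} → Multigraph n m → Fin m → Fin n → Fin n → Set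
Joins G e a b = (G e ≡ (a , b)) ⊎ (G e ≡ (b , a))

-- A cycle of length suc k: distinct vertices vs 0..k and distinct edges es 0..k,
-- edge es i joining vs i and vs (i+1), the last edge es k joining vs k and vs 0.
-- (length 1 = loop, length 2 = pair of parallel edges.)
record Cycle {n m : ℕ} (G : Multigraph n m) : Set where
  field
    len-1 : ℕ
    vs    : Fin (suc len-1) → Fin n
    es    : Fin (suc len-1) → Fin m
    vs-inj : Injective _≡_ _≡_ vs
    es-inj : Injective _≡_ _≡_ es
    step  : (i : Fin len-1) → Joins G (es (inject₁ i)) (vs (inject₁ i)) (vs (suc i))
    close : Joins G (es (fromℕ len-1)) (vs (fromℕ len-1)) (vs zero)

-- F is a feedback vertex set: G[V ∖ F] is a forest, i.e. no cycle of G
-- avoids F (a cycle of G lies in G[V ∖ F] iff all its vertices lie outside F).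
IsFVS : ∀ {n m} → Multigraph n m → Subset n → Set
IsFVS G F = (C : Cycle G) → ¬ ((i : Fin (suc (Cycle.len-1 C))) → Cycle.vs C i ∉ F)

Σ-in : ∀ {n} → Subset n → (Fin n → ℕ) → ℕ
Σ-in {n} S w = Σ-over n (λ v → if lookup S v then w v else 0)

weight : ∀ {n m} → Multigraph n m → Fin n → ℕ
weight G v = deg G v ∸ 3

module Submission where

-- Let F be a feedback vertex set of G with |F| = k, and write w(v) = deg(v) − 3.
-- We show that F itself carries at least 4/11 of the total weight,
--   4 · Σ_V w ≤ 11 · Σ_F w,
-- so sampling v with probability w(v)/Σ_V w hits the feedback vertex set F
-- (of size k) with probability at least 4/11.
--
-- Let D = Σ_{v∈F} deg(v) (edges counted once per endpoint in F) and E the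
-- number of edges of the forest G − F.  Double counting edge endpoints gives
--   Σ_V w + 3n = 2m    and    Σ_F w + 3k = D,
-- every edge lies in G − F or meets F, so  m ≤ E + D,  and a forest has no more
-- edges than vertices, so  E + k ≤ n.  Together with 28k ≤ m these four facts
-- imply the inequality by linear arithmetic.

open import Defs
open import Data.Nat using (ℕ; _≤_; _*_; _+_)
open import Data.Fin using (Fin)
open import Data.Fin.Subset using (Subset; _∈_; ∣_∣)
open import Data.Product using (Σ; ∃; _×_; _,_)
open import Relation.Binary.PropositionalEquality using (_≡_; _≢_)

open import Data.Product using (proj₁; proj₂)
open import Data.Nat using (zero; suc; _<_; _≤?_; z≤n; s≤s; s≤s⁻¹)
open import Data.Nat.Properties
  using (≤-refl; ≤-reflexive; ≤-trans; <-irrefl; +-comm; +-mono-≤; +-monoˡ-≤;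
         +-monoʳ-≤; *-monoˡ-≤; *-monoʳ-≤; +-cancelʳ-≤; +-suc; +-identityʳ;
         *-identityʳ; m≤m+n; n≤1+n; m∸n+n≡m; ≰⇒>; +-*-semiring; module ≤-Reasoning)
open import Data.Nat.Induction using (<-rec)
open import Data.Nat.Tactic.RingSolver using (solve-∀)
open import Data.Nat.ListAction using () renaming (sum to sumₗ)
open import Data.List using () renaming (map to mapₗ; tabulate to tabulateₗ)
open import Data.Fin using (zero; suc; _≟_; inject₁; inject≤; fromℕ)
open import Data.Fin.Properties
  using (suc-injective; inject≤-injective; toℕ-injective;
         toℕ-inject₁; toℕ-inject≤; toℕ-fromℕ; toℕ<n; injective⇒≤; any?)
open import Data.Vec using ([]; _∷_; lookup)
open import Data.Vec.Properties using ([]=⇒lookup)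
open import Data.Vec.Functional using () renaming (_∷_ to _◂_)
open import Data.Bool using (Bool; true; false; T; if_then_else_; _∧_; _∨_; not)
open import Data.Bool.Properties using (T-∧; T-∨; T?)
open import Data.Sum using (_⊎_; inj₁; inj₂)
open import Data.Empty using (⊥; ⊥-elim)
open import Relation.Nullary using (¬_; does; yes; no)
open import Relation.Nullary.Decidable using (_×-dec_)
open import Relation.Binary.PropositionalEquality
  using (refl; sym; trans; cong; cong₂; subst; subst₂; module ≡-Reasoning)
open import Function using (_∘_; Equivalence)
open import Function.Definitions using (Injective)
open import Algebra.Properties.Semiring.Sum +-*-semiring
  using (sum-syntax; sum-cong-≗; sum-replicate-zero; ∑-distrib-+; ∑-comm; *-distribʳ-sum)

sumₗ-tabulate : ∀ {A : Set} k (g : Fin k → A) (f : A → ℕ) →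
                sumₗ (mapₗ f (tabulateₗ g)) ≡ ∑[ i < k ] f (g i)
sumₗ-tabulate zero    g f = refl
sumₗ-tabulate (suc k) g f = cong (f (g zero) +_) (sumₗ-tabulate k (g ∘ suc) f)

Σ-over≡∑ : ∀ k (f : Fin k → ℕ) → Σ-over k f ≡ ∑[ i < k ] f i
Σ-over≡∑ k f = sumₗ-tabulate k (λ i → i) f

∑-mono-≤ : ∀ {k} {f g : Fin k → ℕ} → (∀ i → f i ≤ g i) → ∑[ i < k ] f i ≤ ∑[ i < k ] g i
∑-mono-≤ {zero}  f≤g = z≤n
∑-mono-≤ {suc k} f≤g = +-mono-≤ (f≤g zero) (∑-mono-≤ (f≤g ∘ suc))

∑-const : ∀ k c → ∑[ i < k ] c ≡ k * c
∑-const zero    c = refl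
∑-const (suc k) c = cong (c +_) (∑-const k c)

∑-point : ∀ k (a : Fin k) (f : Fin k → ℕ) → ∑[ v < k ] (if does (v ≟ a) then f v else 0) ≡ f a
∑-point (suc k) zero    f = trans (cong (f zero +_) (sum-replicate-zero k)) (+-identityʳ (f zero))
∑-point (suc k) (suc a) f = ∑-point k a (f ∘ suc)

∑-count : ∀ {k} (F : Subset k) → ∑[ v < k ] ind (lookup F v) ≡ ∣ F ∣
∑-count []          = refl
∑-count (true ∷ F)  = cong suc (∑-count F)
∑-count (false ∷ F) = ∑-count F

witness : ∀ k (P : Fin k → Bool) → 1 ≤ ∑[ i < k ] ind (P i) → ∃ λ i → T (P i)
witness (suc k) P h with P zero in P₀
... | true  = zero , subst T (sym P₀) _
... | false = let i , Pi = witness k (P ∘ suc) h in suc i , Pi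

second-witness : ∀ k (P : Fin k → Bool) (i₀ : Fin k) →
                 2 ≤ ∑[ i < k ] ind (P i) → ∃ λ i → i ≢ i₀ × T (P i)
second-witness (suc k) P zero h with P zero
... | true  = let i , Pi = witness k (P ∘ suc) (s≤s⁻¹ h) in suc i , (λ ()) , Pi
... | false = let i , Pi = witness k (P ∘ suc) (≤-trans (n≤1+n 1) h) in suc i , (λ ()) , Pi
second-witness (suc k) P (suc j) h with P zero in P₀
... | true  = zero , (λ ()) , subst T (sym P₀) _
... | false = let i , i≢j , Pi = second-witness k (P ∘ suc) j h in
              suc i , i≢j ∘ suc-injective , Pi

snoc : ∀ {A : Set} L → (Fin L → A) → A → Fin (suc L) → A
snoc zero    f a zero    = a
snoc (suc L) f a zero    = f zero
snoc (suc L) f a (suc t) = snoc L (f ∘ suc) a t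

snoc-inject₁ : ∀ {A : Set} L (f : Fin L → A) a (t : Fin L) → snoc L f a (inject₁ t) ≡ f t
snoc-inject₁ (suc L) f a zero    = refl
snoc-inject₁ (suc L) f a (suc t) = snoc-inject₁ L (f ∘ suc) a t

snoc-last : ∀ {A : Set} L (f : Fin L → A) a → snoc L f a (fromℕ L) ≡ a
snoc-last zero    f a = refl
snoc-last (suc L) f a = snoc-last L (f ∘ suc) a

last-or-inject₁ : ∀ L (t : Fin (suc L)) → t ≡ fromℕ L ⊎ ∃ λ s → t ≡ inject₁ s
last-or-inject₁ zero    zero    = inj₁ refl
last-or-inject₁ (suc L) zero    = inj₂ (zero , refl)
last-or-inject₁ (suc L) (suc t) with last-or-inject₁ L t
... | inj₁ refl       = inj₁ refl
... | inj₂ (s , refl) = inj₂ (suc s , refl)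

snoc-injective : ∀ {A : Set} L (f : Fin L → A) a →
                 Injective _≡_ _≡_ f → (∀ t → a ≢ f t) → Injective _≡_ _≡_ (snoc L f a)
snoc-injective L f a f-inj fresh {x} {y} eq
  with last-or-inject₁ L x | last-or-inject₁ L y
... | inj₁ refl       | inj₁ refl       = refl
... | inj₁ refl       | inj₂ (t , refl) =
  ⊥-elim (fresh t (trans (sym (snoc-last L f a)) (trans eq (snoc-inject₁ L f a t))))
... | inj₂ (s , refl) | inj₁ refl       =
  ⊥-elim (fresh s (trans (sym (snoc-last L f a)) (trans (sym eq) (snoc-inject₁ L f a s))))
... | inj₂ (s , refl) | inj₂ (t , refl) =
  cong inject₁ (f-inj (trans (sym (snoc-inject₁ L f a s)) (trans eq (snoc-inject₁ L f a t))))

◂-injective : ∀ {A : Set} {l} {a : A} {f : Fin l → A} →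
              (∀ i → a ≢ f i) → Injective _≡_ _≡_ f → Injective _≡_ _≡_ (a ◂ f)
◂-injective fresh f-inj {zero}  {zero}  eq = refl
◂-injective fresh f-inj {zero}  {suc y} eq = ⊥-elim (fresh y eq)
◂-injective fresh f-inj {suc x} {zero}  eq = ⊥-elim (fresh x (sym eq))
◂-injective fresh f-inj {suc x} {suc y} eq = cong suc (f-inj eq)

≟-sound : ∀ {k} {a b : Fin k} → T (does (a ≟ b)) → a ≡ b
≟-sound {a = a} {b} h with a ≟ b
... | yes a≡b = a≡b
... | no  _   = ⊥-elim h

ind-split : ∀ B d₁ d₂ → (if B then ind d₁ + ind d₂ else 0) ≡ (if d₁ then ind B else 0) + (if d₂ then ind B else 0)
ind-split true  d₁    d₂    = refl
ind-split false true  true  = refl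
ind-split false true  false = refl
ind-split false false true  = refl
ind-split false false false = refl

ind-cover : ∀ a b → 1 ≤ ind (not a ∧ not b) + (ind a + ind b)
ind-cover true  b     = s≤s z≤n
ind-cover false true  = s≤s z≤n
ind-cover false false = s≤s z≤n

ind-complement : ∀ b → ind (not b) + ind b ≡ 1
ind-complement true  = refl
ind-complement false = refl

ind-remove : ∀ a d → (T d → T a) → ind a ≡ ind (a ∧ not d) + ind d
ind-remove true  false d⇒a = refl
ind-remove false false d⇒a = refl
ind-remove true  true  d⇒a = refl
ind-remove false true  d⇒a = ⊥-elim (d⇒a _)

ind-remove-edge : ∀ a b da db → ind (a ∧ b) ≤ ind ((a ∧ not da) ∧ (b ∧ not db)) + ind ((da ∨ db) ∧ (a ∧ b))
ind-remove-edge true  true  true  db    = s≤s z≤n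
ind-remove-edge true  true  false true  = s≤s z≤n
ind-remove-edge true  true  false false = s≤s z≤n
ind-remove-edge true  false da    db    = z≤n
ind-remove-edge false b     da    db    = z≤n

module Graph {n m : ℕ} (G : Multigraph n m) where

  end₁ end₂ : Fin m → Fin n
  end₁ e = proj₁ (G e)
  end₂ e = proj₂ (G e)

  incidence : Fin n → Fin m → ℕ
  incidence v e = ind (does (v ≟ end₁ e)) + ind (does (v ≟ end₂ e))

  count : (Fin n → Bool) → ℕ
  count A = ∑[ v < n ] ind (A v)

  ends-in : (Fin n → Bool) → ℕ
  ends-in B = ∑[ e < m ] (ind (B (end₁ e)) + ind (B (end₂ e)))

  degree-sum : (B : Fin n → Bool) → ∑[ v < n ] (if B v then deg G v else 0) ≡ ends-in B
  degree-sum B = begin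
    ∑[ v < n ] (if B v then deg G v else 0)              ≡⟨ sum-cong-≗ expand ⟩
    ∑[ v < n ] ∑[ e < m ] (if B v then incidence v e else 0) ≡⟨ ∑-comm (λ v e → if B v then incidence v e else 0) ⟩
    ∑[ e < m ] ∑[ v < n ] (if B v then incidence v e else 0) ≡⟨ sum-cong-≗ count-ends ⟩
    ends-in B                                           ∎
    where
    open ≡-Reasoning
    expand : ∀ v → (if B v then deg G v else 0) ≡ ∑[ e < m ] (if B v then incidence v e else 0)
    expand v with B v
    ... | true  = Σ-over≡∑ m (incidence v)
    ... | false = sym (sum-replicate-zero m)
    count-ends : ∀ e → ∑[ v < n ] (if B v then incidence v e else 0)
                     ≡ ind (B (end₁ e)) + ind (B (end₂ e))
    count-ends e = begin
      ∑[ v < n ] (if B v then incidence v e else 0)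
        ≡⟨ sum-cong-≗ (λ v → ind-split (B v) (does (v ≟ end₁ e)) (does (v ≟ end₂ e))) ⟩
      ∑[ v < n ] ((if does (v ≟ end₁ e) then ind (B v) else 0) + (if does (v ≟ end₂ e) then ind (B v) else 0))
        ≡⟨ ∑-distrib-+ (λ v → if does (v ≟ end₁ e) then ind (B v) else 0) (λ v → if does (v ≟ end₂ e) then ind (B v) else 0) ⟩
      _ ≡⟨ cong₂ _+_ (∑-point n (end₁ e) (ind ∘ B)) (∑-point n (end₂ e) (ind ∘ B)) ⟩
      ind (B (end₁ e)) + ind (B (end₂ e)) ∎

  weight-sum : (∀ v → 3 ≤ deg G v) → (B : Fin n → Bool) →
               ∑[ v < n ] (if B v then weight G v else 0) + count B * 3 ≡ ends-in B
  weight-sum deg≥3 B = begin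
    ∑[ v < n ] (if B v then weight G v else 0) + count B * 3
      ≡⟨ cong (∑[ v < n ] (if B v then weight G v else 0) +_) (*-distribʳ-sum 3 (ind ∘ B)) ⟩
    ∑[ v < n ] (if B v then weight G v else 0) + ∑[ v < n ] (ind (B v) * 3)
      ≡⟨ sym (∑-distrib-+ (λ v → if B v then weight G v else 0) (λ v → ind (B v) * 3)) ⟩
    ∑[ v < n ] ((if B v then weight G v else 0) + ind (B v) * 3)
      ≡⟨ sum-cong-≗ restore ⟩
    ∑[ v < n ] (if B v then deg G v else 0)
      ≡⟨ degree-sum B ⟩
    ends-in B ∎
    where
    open ≡-Reasoning
    restore : ∀ v → (if B v then weight G v else 0) + ind (B v) * 3 ≡ (if B v then deg G v else 0)
    restore v with B v
    ... | true  = m∸n+n≡m (deg≥3 v)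
    ... | false = refl

  within : (Fin n → Bool) → Fin m → Bool
  within A e = A (end₁ e) ∧ A (end₂ e)

  touches : Fin n → Fin m → Bool
  touches x e = does (end₁ e ≟ x) ∨ does (end₂ e ≟ x)

  inner : (Fin n → Bool) → ℕ
  inner A = ∑[ e < m ] ind (within A e)

  inner-deg : (Fin n → Bool) → Fin n → ℕ
  inner-deg A x = ∑[ e < m ] ind (touches x e ∧ within A e)

  edges-covered : (B : Fin n → Bool) → m ≤ inner (not ∘ B) + ends-in B
  edges-covered B = begin
    m                 ≡⟨ sym (trans (∑-const m 1) (*-identityʳ m)) ⟩
    ∑[ e < m ] 1      ≤⟨ ∑-mono-≤ (λ e → ind-cover (B (end₁ e)) (B (end₂ e))) ⟩
    ∑[ e < m ] (ind (within (not ∘ B) e) + (ind (B (end₁ e)) + ind (B (end₂ e))))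
                      ≡⟨ ∑-distrib-+ (ind ∘ within (not ∘ B)) (λ e → ind (B (end₁ e)) + ind (B (end₂ e))) ⟩
    inner (not ∘ B) + ends-in B ∎
    where open ≤-Reasoning

  count-complement : (B : Fin n → Bool) → count (not ∘ B) + count B ≡ n
  count-complement B = begin
    count (not ∘ B) + count B               ≡⟨ sym (∑-distrib-+ (λ v → ind (not (B v))) (ind ∘ B)) ⟩
    ∑[ v < n ] (ind (not (B v)) + ind (B v)) ≡⟨ sum-cong-≗ (ind-complement ∘ B) ⟩
    ∑[ v < n ] 1                            ≡⟨ trans (∑-const n 1) (*-identityʳ n) ⟩
    n ∎
    where open ≡-Reasoning

  CycleIn : (Fin n → Bool) → Set
  CycleIn A = Σ (Cycle G) λ C → ∀ i → T (A (Cycle.vs C i))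

  InducesForest : (Fin n → Bool) → Set
  InducesForest A = ¬ CycleIn A

  joins-sym : ∀ {e a b} → Joins G e a b → Joins G e b a
  joins-sym (inj₁ eq) = inj₂ eq
  joins-sym (inj₂ eq) = inj₁ eq

  joins-unique : ∀ {e a b c d} → Joins G e a b → Joins G e c d → (a ≡ c × b ≡ d) ⊎ (a ≡ d × b ≡ c)
  joins-unique (inj₁ refl) (inj₁ refl) = inj₁ (refl , refl)
  joins-unique (inj₁ refl) (inj₂ refl) = inj₂ (refl , refl)
  joins-unique (inj₂ refl) (inj₁ refl) = inj₂ (refl , refl)
  joins-unique (inj₂ refl) (inj₂ refl) = inj₁ (refl , refl)

  other-end : ∀ A x e → T (touches x e ∧ within A e) → ∃ λ w → Joins G e x w × T (A w)
  other-end A x e h with Equivalence.to T-∧ h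
  ... | at-x , in-A with Equivalence.to T-∧ in-A | Equivalence.to T-∨ at-x
  ... | A₁ , A₂ | inj₁ e₁≡x = end₂ e , inj₁ (cong (_, end₂ e) (≟-sound e₁≡x)) , A₂
  ... | A₁ , A₂ | inj₂ e₂≡x = end₁ e , inj₂ (cong (end₁ e ,_) (≟-sound e₂≡x)) , A₁

  record Path (A : Fin n → Bool) (l : ℕ) : Set where
    field
      vertex     : Fin (suc l) → Fin n
      edge       : Fin l → Fin m
      vertex-inj : Injective _≡_ _≡_ vertex
      edge-inj   : Injective _≡_ _≡_ edge
      link       : (i : Fin l) → Joins G (edge i) (vertex (inject₁ i)) (vertex (suc i))
      inside     : (i : Fin (suc l)) → T (A (vertex i))

  HeadFresh : ∀ {A l} → Path A l → Fin m → Set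
  HeadFresh {l = l} P e = (i : Fin l) → inject₁ i ≡ zero → e ≢ Path.edge P i

  -- An edge e ≠ (first edge) from the head back to the path vertex j closes
  -- the cycle  vertex 0, …, vertex j  (a loop if j = 0, a double edge if j = 1).
  close-cycle : ∀ {A l} (P : Path A l) {e w} → Joins G e (Path.vertex P zero) w → HeadFresh P e →
                (j : Fin (suc l)) → Path.vertex P j ≡ w → CycleIn A
  close-cycle {A} {l} P {e} {w} e-joins e-fresh j vertex-j≡w = C , λ t → inside (inject≤ t j<)
    where
    open Path P
    L = Data.Fin.toℕ j
    j< : suc L ≤ suc l
    j< = toℕ<n j
    j≤ : L ≤ l
    j≤ = s≤s⁻¹ j<
    arc : Fin L → Fin m
    arc t = edge (inject≤ t j≤)
    e∉arc : ∀ t → e ≢ arc t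
    e∉arc t refl with joins-unique e-joins (link (inject≤ t j≤))
    ... | inj₁ (head≡ , _) = e-fresh (inject≤ t j≤) (sym (vertex-inj head≡)) refl
    ... | inj₂ (head≡ , _) with vertex-inj head≡
    ... | ()
    es : Fin (suc L) → Fin m
    es = snoc L arc e
    inject-commute : ∀ i → inject₁ (inject≤ i j≤) ≡ inject≤ (inject₁ i) j<
    inject-commute i = toℕ-injective (trans (toℕ-inject₁ _) (trans (toℕ-inject≤ i j≤)
                         (sym (trans (toℕ-inject≤ _ j<) (toℕ-inject₁ i)))))
    last≡j : inject≤ (fromℕ L) j< ≡ j
    last≡j = toℕ-injective (trans (toℕ-inject≤ _ j<) (toℕ-fromℕ L))
    C : Cycle G
    C = record
      { len-1  = L
      ; vs     = λ t → vertex (inject≤ t j<)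
      ; es     = es
      ; vs-inj = λ eq → inject≤-injective j< j< _ _ (vertex-inj eq)
      ; es-inj = snoc-injective L arc e (λ eq → inject≤-injective j≤ j≤ _ _ (edge-inj eq)) e∉arc
      ; step   = λ i → subst₂ (λ f u → Joins G f (vertex u) (vertex (inject≤ (suc i) j<)))
                                (sym (snoc-inject₁ L arc e i)) (inject-commute i) (link (inject≤ i j≤))
      ; close  = subst₂ (λ f u → Joins G f u (vertex zero)) (sym (snoc-last L arc e))
                         (trans (sym vertex-j≡w) (cong vertex (sym last≡j))) (joins-sym e-joins)
      }

  extend : ∀ {A l} (P : Path A l) {e w} → Joins G e (Path.vertex P zero) w → T (A w) →
           (∀ i → Path.vertex P i ≢ w) → Path A (suc l)
  extend {A} P {e} {w} e-joins A-w w-new = record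
    { vertex     = w ◂ vertex
    ; edge       = e ◂ edge
    ; vertex-inj = ◂-injective (λ i eq → w-new i (sym eq)) vertex-inj
    ; edge-inj   = ◂-injective e-new edge-inj
    ; link       = λ { zero → joins-sym e-joins ; (suc i) → link i }
    ; inside     = λ { zero → A-w ; (suc i) → inside i }
    }
    where
    open Path P
    e-new : ∀ i → e ≢ edge i
    e-new i refl with joins-unique e-joins (link i)
    ... | inj₁ (_ , w≡) = w-new (suc i) (sym w≡)
    ... | inj₂ (_ , w≡) = w-new (inject₁ i) (sym w≡)

  next-edge : ∀ {A l} → (∀ x → T (A x) → 2 ≤ inner-deg A x) → (P : Path A l) →
              ∃ λ e → T (touches (Path.vertex P zero) e ∧ within A e) × HeadFresh P e
  next-edge {A} {zero} deg≥2 P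
    with witness m _ (≤-trans (n≤1+n 1) (deg≥2 _ (Path.inside P zero)))
  ... | e , good = e , good , λ ()
  next-edge {A} {suc l} deg≥2 P
    with second-witness m _ (Path.edge P zero) (deg≥2 _ (Path.inside P zero))
  ... | e , e≢first , good = e , good , λ { zero _ → e≢first ; (suc i) () }

  -- Minimum induced degree 2 forces a cycle: walk from any vertex along
  -- fresh edges; as the path cannot exceed n vertices, it must close up.
  core-has-cycle : ∀ A → (∀ x → T (A x) → 2 ≤ inner-deg A x) → ∀ x₀ → T (A x₀) → CycleIn A
  core-has-cycle A deg≥2 x₀ A-x₀ = walk n 0 (≤-reflexive (sym (+-identityʳ n))) trivial
    where
    trivial : Path A 0
    trivial = record { vertex = λ _ → x₀ ; edge = λ () ; vertex-inj = λ { {zero} {zero} _ → refl }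
                     ; edge-inj = λ { {()} } ; link = λ () ; inside = λ { zero → A-x₀ } }
    -- the fuel bounds the number of further extensions (a path has < n edges)
    walk : ∀ fuel l → n ≤ fuel + l → Path A l → CycleIn A
    walk zero l n≤l P = ⊥-elim (<-irrefl refl (≤-trans (injective⇒≤ (Path.vertex-inj P)) n≤l))
    walk (suc fuel) l n≤ P with next-edge deg≥2 P
    ... | e , good , e-fresh with other-end A _ e good
    ... | w , e-joins , A-w with any? (λ j → Path.vertex P j ≟ w)
    ... | yes (j , vertex-j≡w) = close-cycle P e-joins e-fresh j vertex-j≡w
    ... | no w-new = walk fuel (suc l) (subst (n ≤_) (sym (+-suc fuel l)) n≤)
                          (extend P e-joins A-w (λ i eq → w-new (i , eq)))

  module Delete (A : Fin n → Bool) (x : Fin n) (A-x : T (A x)) where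
    A′ : Fin n → Bool
    A′ v = A v ∧ not (does (v ≟ x))

    count-delete : count A ≡ count A′ + 1
    count-delete = begin
      count A ≡⟨ sum-cong-≗ (λ v → ind-remove (A v) (does (v ≟ x)) (λ v≡x → subst (T ∘ A) (sym (≟-sound v≡x)) A-x)) ⟩
      ∑[ v < n ] (ind (A′ v) + ind (does (v ≟ x))) ≡⟨ ∑-distrib-+ (ind ∘ A′) (λ v → ind (does (v ≟ x))) ⟩
      count A′ + ∑[ v < n ] ind (does (v ≟ x))      ≡⟨ cong (count A′ +_) (∑-point n x (λ _ → 1)) ⟩
      count A′ + 1 ∎
      where open ≡-Reasoning

    inner-delete : inner A ≤ inner A′ + inner-deg A x
    inner-delete = ≤-trans
      (∑-mono-≤ (λ e → ind-remove-edge (A (end₁ e)) (A (end₂ e)) (does (end₁ e ≟ x)) (does (end₂ e ≟ x))))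
      (≤-reflexive (∑-distrib-+ (ind ∘ within A′) (λ e → ind (touches x e ∧ within A e))))

    forest-delete : InducesForest A → InducesForest A′
    forest-delete forest (C , in-A′) = forest (C , λ i → proj₁ (Equivalence.to T-∧ (in-A′ i)))

  forest-bound : ∀ A → InducesForest A → inner A ≤ count A
  forest-bound A₀ = <-rec Claim step (count A₀) A₀ refl
    where
    Claim : ℕ → Set
    Claim c = ∀ A → count A ≡ c → InducesForest A → inner A ≤ count A

    no-vertices : ∀ A → ¬ (∃ λ x → T (A x)) → inner A ≤ count A
    no-vertices A empty = ≤-trans (∑-mono-≤ none-within) (≤-trans (≤-reflexive (sum-replicate-zero m)) z≤n)
      where
      none-within : ∀ e → ind (within A e) ≤ 0
      none-within e with A (end₁ e) in eq
      ... | true  = ⊥-elim (empty (end₁ e , subst T (sym eq) _))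
      ... | false = z≤n

    -- Delete a vertex of induced degree ≤ 1 if there is one; otherwise A is
    -- empty or contains a cycle by core-has-cycle.
    step : ∀ c → (∀ {c′} → c′ < c → Claim c′) → Claim c
    step c ih A refl forest with any? (λ x → T? (A x) ×-dec (inner-deg A x ≤? 1))
    ... | yes (x , A-x , low) = begin
          inner A                    ≤⟨ inner-delete ⟩
          inner A′ + inner-deg A x   ≤⟨ +-mono-≤ (ih smaller A′ refl (forest-delete forest)) low ⟩
          count A′ + 1               ≡⟨ sym count-delete ⟩
          count A ∎
      where
      open Delete A x A-x
      open ≤-Reasoning
      smaller : count A′ < count A
      smaller = subst (count A′ <_) (trans (+-comm 1 (count A′)) (sym count-delete)) ≤-refl
    ... | no no-low with any? (λ x → T? (A x))
    ... | no empty = no-vertices A empty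
    ... | yes (x₀ , A-x₀) = ⊥-elim (forest (core-has-cycle A deg≥2 x₀ A-x₀))
      where
      deg≥2 : ∀ x → T (A x) → 2 ≤ inner-deg A x
      deg≥2 x A-x with inner-deg A x ≤? 1
      ... | yes low = ⊥-elim (no-low (x , A-x , low))
      ... | no  d   = ≰⇒> d

-- With W = Σ_V w, W_F = Σ_F w, D the endpoints in F and E the edges of G − F,
-- the four counting facts and 28k ≤ m give 4W ≤ 11 W_F.  (Eliminating W, W_F
-- and D, the claim reduces to 22k ≤ 3m + n, which follows from 28k ≤ m.)
weight-inequality : ∀ W W-F n m k D E → W + n * 3 ≡ m * 2 → W-F + k * 3 ≡ D →
                    m ≤ E + D → E + k ≤ n → 28 * k ≤ m → 4 * W ≤ 11 * W-F
weight-inequality W W-F n m k D E total in-F covered forest 28k≤m =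
  +-cancelʳ-≤ (n * 12 + k * 33) (4 * W) (11 * W-F) (begin
    4 * W + (n * 12 + k * 33)    ≡⟨ reassoc₁ W n k ⟩
    4 * (W + n * 3) + k * 33     ≡⟨ cong (λ z → 4 * z + k * 33) total ⟩
    4 * (m * 2) + k * 33         ≡⟨ split m k ⟩
    (m * 8 + k * 11) + 22 * k    ≤⟨ +-monoʳ-≤ (m * 8 + k * 11) 22k≤3m ⟩
    (m * 8 + k * 11) + 3 * m     ≡⟨ regroup m k ⟩
    11 * (m + k)                 ≤⟨ *-monoʳ-≤ 11 m+k≤n+D ⟩
    11 * (n + D)                 ≤⟨ m≤m+n _ n ⟩
    11 * (n + D) + n             ≡⟨ cong (λ z → 11 * (n + z) + n) (sym in-F) ⟩
    11 * (n + (W-F + k * 3)) + n ≡⟨ reassoc₂ W-F n k ⟩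
    11 * W-F + (n * 12 + k * 33) ∎)
  where
  open ≤-Reasoning
  reassoc₁ : ∀ W n k → 4 * W + (n * 12 + k * 33) ≡ 4 * (W + n * 3) + k * 33
  reassoc₁ = solve-∀
  reassoc₂ : ∀ W-F n k → 11 * (n + (W-F + k * 3)) + n ≡ 11 * W-F + (n * 12 + k * 33)
  reassoc₂ = solve-∀
  split : ∀ m k → 4 * (m * 2) + k * 33 ≡ (m * 8 + k * 11) + 22 * k
  split = solve-∀
  regroup : ∀ m k → (m * 8 + k * 11) + 3 * m ≡ 11 * (m + k)
  regroup = solve-∀
  22k≤3m : 22 * k ≤ 3 * m
  22k≤3m = ≤-trans (*-monoˡ-≤ k (m≤m+n 22 6)) (≤-trans 28k≤m (m≤m+n m (2 * m)))
  m+k≤n+D : m + k ≤ n + D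
  m+k≤n+D = ≤-trans (+-monoˡ-≤ k covered) (≤-trans (≤-reflexive (exchange E D k)) (+-monoˡ-≤ D forest))
    where exchange : ∀ E D k → E + D + k ≡ E + k + D
          exchange = solve-∀

fvs-carries-weight : ∀ n m k (G : Multigraph n m) → (∀ v → 3 ≤ deg G v) →
                     (F : Subset n) → IsFVS G F → ∣ F ∣ ≡ k → 28 * k ≤ m →
                     4 * Σ-over n (weight G) ≤ 11 * Σ-in F (weight G)
fvs-carries-weight n m k G deg≥3 F fvs |F|≡k 28k≤m =
  weight-inequality W W-F n m k (ends-in B) (inner (not ∘ B))
    total in-F (edges-covered B) forest-edges 28k≤m
  where
  open Graph G
  B : Fin n → Bool
  B = lookup F
  W W-F : ℕ
  W   = Σ-over n (weight G)
  W-F = Σ-in F (weight G)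
  |B|≡k : count B ≡ k
  |B|≡k = trans (∑-count F) |F|≡k
  total : W + n * 3 ≡ m * 2
  total = begin
    W + n * 3                                ≡⟨ cong₂ _+_ (Σ-over≡∑ n (weight G)) (cong (_* 3) (sym (trans (∑-const n 1) (*-identityʳ n)))) ⟩
    ∑[ v < n ] weight G v + count (λ _ → true) * 3 ≡⟨ weight-sum deg≥3 (λ _ → true) ⟩
    ends-in (λ _ → true)                     ≡⟨ ∑-const m 2 ⟩
    m * 2 ∎
    where open ≡-Reasoning
  in-F : W-F + k * 3 ≡ ends-in B
  in-F = trans (cong₂ _+_ (Σ-over≡∑ n _) (cong (_* 3) (sym |B|≡k))) (weight-sum deg≥3 B)
  outside-F-forest : InducesForest (not ∘ B)
  outside-F-forest (C , outside) = fvs C (λ i v∈F → outside-F (outside i) ([]=⇒lookup v∈F))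
    where
    outside-F : ∀ {b} → T (not b) → b ≡ true → ⊥
    outside-F {true}  () _
    outside-F {false} _  ()
  forest-edges : inner (not ∘ B) + k ≤ n
  forest-edges = begin
    inner (not ∘ B) + k        ≤⟨ +-monoˡ-≤ k (forest-bound (not ∘ B) outside-F-forest) ⟩
    count (not ∘ B) + k        ≡⟨ cong (count (not ∘ B) +_) (sym |B|≡k) ⟩
    count (not ∘ B) + count B  ≡⟨ count-complement B ⟩
    n ∎
    where open ≤-Reasoning

-- Lemma 9.  Sampling v with probability (deg v − 3)/Σ(deg u − 3) hits the set
-- S = F, all of whose vertices lie in a feedback vertex set of size ≤ k, with
-- probability ≥ 4/11.  Only the degree bound, the feedback vertex set and
-- 28k ≤ m enter the inequality.
lemma9 : (n m k : ℕ) (G : Multigraph n m) → k ≤ n → NoLoops G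
    → ((u v : Fin n) → u ≢ v → mult G u v ≤ 2)
    → ((v : Fin n) → 3 ≤ deg G v)
    → ∃ (λ (v : Fin n) → 4 ≤ deg G v)
    → ∃ (λ (F : Subset n) → IsFVS G F × ∣ F ∣ ≡ k)
    → 28 * k ≤ m
    → Σ (Subset n) (λ S →
    ((v : Fin n) → v ∈ S → ∃ (λ (F : Subset n) → IsFVS G F × ∣ F ∣ ≤ k × v ∈ F))
    × 4 * Σ-over n (weight G) ≤ 11 * Σ-in S (weight G))
lemma9 n m k G _ _ _ deg≥3 _ (F , fvs , |F|≡k) 28k≤m =
  F , (λ v v∈F → F , fvs , ≤-reflexive |F|≡k , v∈F) , fvs-carries-weight n m k G deg≥3 F fvs |F|≡k 28k≤m
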